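{- Every weakly $\epsilon$-modular set function is $2\epsilon$-modular.
   Context: A set function on a finite ground set $U$ is a map $f:2^U\to\mathbb{R}$. It is $\epsilon$-modular if $|f(S)+f(T)-f(S\cup T)-f(S\cap T)|\le\epsilon$ for all $S,T\subseteq U$, and weakly $\epsilon$-modular if this inequality holds for all disjoint $S,T\subseteq U$. -}

module Defs where

open import Level using (Level; _⊔_; suc)
open import Data.Nat using (ℕ)
open import Data.Product using (_×_)
open import Relation.Binary.PropositionalEquality using (_≡_)
open import Relation.Binary.Structures using (IsTotalOrder)
open import Algebra.Bundles using (AbelianGroup)
open import Data.Fin.Subset using (Subset; _∪_; _∩_; ⊥)

-- A totally ordered abelian group: an abelian group (with its setoid
-- equality _≈_) equipped with a total order compatible with _≈_ and
-- translation invariant.  ℝ (with +, ≤) is the instance of the paper;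
-- we state the result for every such structure, which covers ℝ.
record OrderedAbelianGroup (c ℓ₁ ℓ₂ : Level) : Set (suc (c ⊔ ℓ₁ ⊔ ℓ₂)) where
  field
    abelianGroup : AbelianGroup c ℓ₁
  open AbelianGroup abelianGroup public
  infix 4 _≤_
  field
    _≤_          : Carrier → Carrier → Set ℓ₂
    isTotalOrder : IsTotalOrder _≈_ _≤_
    +-mono-≤     : ∀ {x y} z → x ≤ y → x ∙ z ≤ y ∙ z

  AbsLe : Carrier → Carrier → Set ℓ₂
  AbsLe x ε = (ε ⁻¹ ≤ x) × (x ≤ ε)

module _ {c ℓ₁ ℓ₂ : Level} (G : OrderedAbelianGroup c ℓ₁ ℓ₂) where
  open OrderedAbelianGroup G

  SetFunction : ℕ → Set c
  SetFunction n = Subset n → Carrier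

  Disjoint : {n : ℕ} → Subset n → Subset n → Set
  Disjoint S T = S ∩ T ≡ ⊥

  modDefect : {n : ℕ} → SetFunction n → Subset n → Subset n → Carrier
  modDefect f S T = ((f S ∙ f T) ∙ (f (S ∪ T) ⁻¹)) ∙ (f (S ∩ T) ⁻¹)

  IsModular : {n : ℕ} → Carrier → SetFunction n → Set (ℓ₂)
  IsModular ε f = ∀ S T → AbsLe (modDefect f S T) ε

  IsWeaklyModular : {n : ℕ} → Carrier → SetFunction n → Set (ℓ₂)
  IsWeaklyModular ε f = ∀ S T → Disjoint S T → AbsLe (modDefect f S T) ε

-- Split S into the disjoint pieces A = S ∖ T and S ∩ T.  Then A, T and A, S ∩ T
-- are disjoint pairs, and the modularity defect telescopes:
--   δ(S, T) = δ(A, T) − δ(A, S ∩ T),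
-- so |δ(S, T)| ≤ ε + ε.
module Submission where

open import Level using (Level)
open import Data.Nat using (ℕ)
open import Data.Fin.Subset using (Subset; _∪_; _∩_; ∁) renaming (⊥ to ∅)
open import Data.Fin.Subset.Properties using (∪-∩-booleanAlgebra)
open import Data.Product using (_,_)
open import Relation.Binary.PropositionalEquality as ≡ using (_≡_)
open import Relation.Binary.Structures using (IsTotalOrder)
open import Algebra.Bundles using (AbelianGroup)
open import Algebra.Lattice.Bundles using (BooleanAlgebra)
import Algebra.Lattice.Properties.BooleanAlgebra as BooleanAlgebraProperties
import Algebra.Properties.AbelianGroup as AbelianGroupProperties
import Algebra.Properties.Group as GroupProperties
import Algebra.Solver.CommutativeMonoid as CommutativeMonoidSolver
import Relation.Binary.Reasoning.Setoid as SetoidReasoning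
open import Defs

module RelativeComplement {c ℓ} (B : BooleanAlgebra c ℓ) where
  open BooleanAlgebra B
  open BooleanAlgebraProperties B using (∧-identityʳ; ∧-zeroˡ; ∧-zeroʳ)
  open SetoidReasoning setoid

  x∧¬y∨x∧y≈x : ∀ x y → (x ∧ ¬ y) ∨ (x ∧ y) ≈ x
  x∧¬y∨x∧y≈x x y = begin
    (x ∧ ¬ y) ∨ (x ∧ y) ≈⟨ sym (∧-distribˡ-∨ x (¬ y) y) ⟩
    x ∧ (¬ y ∨ y)       ≈⟨ ∧-congˡ (∨-complementˡ y) ⟩
    x ∧ ⊤               ≈⟨ ∧-identityʳ x ⟩
    x                   ∎

  x∧¬y∨y≈x∨y : ∀ x y → (x ∧ ¬ y) ∨ y ≈ x ∨ y
  x∧¬y∨y≈x∨y x y = begin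
    (x ∧ ¬ y) ∨ y       ≈⟨ ∨-distribʳ-∧ y x (¬ y) ⟩
    (x ∨ y) ∧ (¬ y ∨ y) ≈⟨ ∧-congˡ (∨-complementˡ y) ⟩
    (x ∨ y) ∧ ⊤         ≈⟨ ∧-identityʳ (x ∨ y) ⟩
    x ∨ y               ∎

  x∧¬y∧y≈⊥ : ∀ x y → (x ∧ ¬ y) ∧ y ≈ ⊥
  x∧¬y∧y≈⊥ x y = begin
    (x ∧ ¬ y) ∧ y ≈⟨ ∧-assoc x (¬ y) y ⟩
    x ∧ (¬ y ∧ y) ≈⟨ ∧-congˡ (∧-complementˡ y) ⟩
    x ∧ ⊥         ≈⟨ ∧-zeroʳ x ⟩
    ⊥             ∎

  x∧¬y∧x∧y≈⊥ : ∀ x y → (x ∧ ¬ y) ∧ (x ∧ y) ≈ ⊥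
  x∧¬y∧x∧y≈⊥ x y = begin
    (x ∧ ¬ y) ∧ (x ∧ y) ≈⟨ ∧-congˡ (∧-comm x y) ⟩
    (x ∧ ¬ y) ∧ (y ∧ x) ≈⟨ sym (∧-assoc (x ∧ ¬ y) y x) ⟩
    ((x ∧ ¬ y) ∧ y) ∧ x ≈⟨ ∧-congʳ (x∧¬y∧y≈⊥ x y) ⟩
    ⊥ ∧ x               ≈⟨ ∧-zeroˡ x ⟩
    ⊥                   ∎

module AbelianGroupLemmas {c ℓ} (G : AbelianGroup c ℓ) where
  open AbelianGroup G
  open SetoidReasoning setoid

  defect-telescope : ∀ a b u i p z →
    (((a ∙ b) ∙ u ⁻¹) ∙ i ⁻¹) ∙ (((p ∙ i) ∙ a ⁻¹) ∙ z ⁻¹) ≈ ((p ∙ b) ∙ u ⁻¹) ∙ z ⁻¹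
  defect-telescope a b u i p z = begin
    (((a ∙ b) ∙ u ⁻¹) ∙ i ⁻¹) ∙ (((p ∙ i) ∙ a ⁻¹) ∙ z ⁻¹)
      ≈⟨ regroup a (a ⁻¹) i (i ⁻¹) p b (u ⁻¹) (z ⁻¹) ⟩
    ((a ∙ a ⁻¹) ∙ (i ∙ i ⁻¹)) ∙ (((p ∙ b) ∙ u ⁻¹) ∙ z ⁻¹)
      ≈⟨ ∙-congʳ (∙-cong (inverseʳ a) (inverseʳ i)) ⟩
    (ε ∙ ε) ∙ (((p ∙ b) ∙ u ⁻¹) ∙ z ⁻¹)
      ≈⟨ trans (∙-congʳ (identityˡ ε)) (identityˡ _) ⟩
    ((p ∙ b) ∙ u ⁻¹) ∙ z ⁻¹
      ∎
    where
    open CommutativeMonoidSolver commutativeMonoid using (solve; _⊜_; _⊕_)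
    regroup : ∀ a a⁻ i i⁻ p b u⁻ z⁻ →
      (((a ∙ b) ∙ u⁻) ∙ i⁻) ∙ (((p ∙ i) ∙ a⁻) ∙ z⁻) ≈ ((a ∙ a⁻) ∙ (i ∙ i⁻)) ∙ (((p ∙ b) ∙ u⁻) ∙ z⁻)
    regroup = solve 8 (λ a a⁻ i i⁻ p b u⁻ z⁻ →
      (((a ⊕ b) ⊕ u⁻) ⊕ i⁻) ⊕ (((p ⊕ i) ⊕ a⁻) ⊕ z⁻) ⊜ ((a ⊕ a⁻) ⊕ (i ⊕ i⁻)) ⊕ (((p ⊕ b) ⊕ u⁻) ⊕ z⁻))
      refl

module OrderedAbelianGroupLemmas {c ℓ₁ ℓ₂} (G : OrderedAbelianGroup c ℓ₁ ℓ₂) where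
  open OrderedAbelianGroup G
  open IsTotalOrder isTotalOrder using (≤-respˡ-≈; ≤-respʳ-≈) renaming (trans to ≤-trans)
  open AbelianGroupProperties abelianGroup using (⁻¹-∙-comm)
  open GroupProperties group using (⁻¹-involutive; \\-leftDividesˡ; //-rightDividesʳ)
  open AbelianGroupLemmas abelianGroup

  ∙-mono-≤ : ∀ {x y u v} → x ≤ y → u ≤ v → x ∙ u ≤ y ∙ v
  ∙-mono-≤ {y = y} {u} {v} x≤y u≤v = ≤-trans (+-mono-≤ u x≤y)
    (≤-respˡ-≈ (comm u y) (≤-respʳ-≈ (comm v y) (+-mono-≤ y u≤v)))

  -- Add x⁻¹ ∙ y⁻¹ to both sides of x ≤ y.
  ⁻¹-antimono-≤ : ∀ {x y} → x ≤ y → y ⁻¹ ≤ x ⁻¹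
  ⁻¹-antimono-≤ {x} {y} x≤y =
    ≤-respʳ-≈ (trans (∙-congˡ (comm _ _)) (\\-leftDividesˡ y (x ⁻¹)))
      (≤-respˡ-≈ (\\-leftDividesˡ x (y ⁻¹)) (+-mono-≤ (x ⁻¹ ∙ y ⁻¹) x≤y))

  AbsLe-respˡ-≈ : ∀ {x y e} → x ≈ y → AbsLe x e → AbsLe y e
  AbsLe-respˡ-≈ x≈y (lower , upper) = ≤-respʳ-≈ x≈y lower , ≤-respˡ-≈ x≈y upper

  AbsLe-⁻¹ : ∀ {x e} → AbsLe x e → AbsLe (x ⁻¹) e
  AbsLe-⁻¹ {e = e} (e⁻¹≤x , x≤e) =
    ⁻¹-antimono-≤ x≤e , ≤-respʳ-≈ (⁻¹-involutive e) (⁻¹-antimono-≤ e⁻¹≤x)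

  AbsLe-∙ : ∀ {x y d e} → AbsLe x d → AbsLe y e → AbsLe (x ∙ y) (d ∙ e)
  AbsLe-∙ {d = d} {e} (d⁻¹≤x , x≤d) (e⁻¹≤y , y≤e) =
    ≤-respˡ-≈ (⁻¹-∙-comm d e) (∙-mono-≤ d⁻¹≤x e⁻¹≤y) , ∙-mono-≤ x≤d y≤e

  modDefect-telescope : ∀ {n} (f : SetFunction G n) (S T A : Subset n) →
    A ∪ (S ∩ T) ≡ S → A ∪ T ≡ S ∪ T → A ∩ (S ∩ T) ≡ A ∩ T →
    modDefect G f S T ≈ modDefect G f A T ∙ modDefect G f A (S ∩ T) ⁻¹
  modDefect-telescope f S T A A∪S∩T≡S A∪T≡S∪T A∩S∩T≡A∩T
    rewrite A∪S∩T≡S | A∪T≡S∪T | A∩S∩T≡A∩T =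
    trans (sym (//-rightDividesʳ _ _))
      (∙-congʳ (defect-telescope (f S) (f T) (f (S ∪ T)) (f (S ∩ T)) (f A) (f (A ∩ T))))

proposition1 : {c ℓ₁ ℓ₂ : Level} (G : OrderedAbelianGroup c ℓ₁ ℓ₂) (n : ℕ)
    (ε : OrderedAbelianGroup.Carrier G) (f : SetFunction G n) →
    IsWeaklyModular G ε f →
    IsModular G (OrderedAbelianGroup._∙_ G ε ε) f
proposition1 G n ε f weaklyModular S T =
  AbsLe-respˡ-≈ (sym (modDefect-telescope f S T A
                       (x∧¬y∨x∧y≈x S T) (x∧¬y∨y≈x∨y S T) (≡.trans A∩S∩T≡∅ (≡.sym A∩T≡∅))))
    (AbsLe-∙ (weaklyModular A T A∩T≡∅) (AbsLe-⁻¹ (weaklyModular A (S ∩ T) A∩S∩T≡∅)))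
  where
  open OrderedAbelianGroup G using (sym)
  open OrderedAbelianGroupLemmas G
  open RelativeComplement (∪-∩-booleanAlgebra n)
  A : Subset n
  A = S ∩ ∁ T
  A∩T≡∅ : A ∩ T ≡ ∅
  A∩T≡∅ = x∧¬y∧y≈⊥ S T
  A∩S∩T≡∅ : A ∩ (S ∩ T) ≡ ∅
  A∩S∩T≡∅ = x∧¬y∧x∧y≈⊥ S T
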